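{- There is $d_0$ such that the following holds for all $d\geq d_0$. Let $G$ be a graph on $n$ vertices with average degree $d$. Then there exists a non-empty bipartite subgraph $G'$ of $G$ with parts $X$ and $Y$ such that $e(G')\geq |X|\cdot \frac{\Delta(G')}{80}$ and $e(G')\geq |Y|\cdot \frac{d}{10\log n}$.
   Context: Logarithms are base 2. $e(G')$ is the number of edges and $\Delta(G')$ the maximum degree of $G'$. -}

module Defs where

open import Data.Nat using (ℕ; zero; suc; _+_; _⊔_; _<ᵇ_)
open import Data.Bool using (Bool; true; false; _∧_; if_then_else_)
open import Data.Fin using (Fin; toℕ)
open import Data.Fin.Subset using (Subset; _∈_)
open import Data.Product using (_×_)
open import Data.Sum using (_⊎_)
open import Data.Empty using (⊥)
open import Relation.Binary.PropositionalEquality using (_≡_)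

count : ∀ {n} → (Fin n → Bool) → ℕ
count {zero}  p = 0
count {suc n} p = (if p Data.Fin.zero then 1 else 0) + count (λ i → p (Data.Fin.suc i))

sumFin : ∀ {n} → (Fin n → ℕ) → ℕ
sumFin {zero}  f = 0
sumFin {suc n} f = f Data.Fin.zero + sumFin (λ i → f (Data.Fin.suc i))

maxFin : ∀ {n} → (Fin n → ℕ) → ℕ
maxFin {zero}  f = 0
maxFin {suc n} f = f Data.Fin.zero ⊔ maxFin (λ i → f (Data.Fin.suc i))

record Graph (n : ℕ) : Set where
  field
    adj    : Fin n → Fin n → Bool
    sym    : ∀ i j → adj i j ≡ adj j i
    irrefl : ∀ i → adj i i ≡ false
open Graph public

edgeCount : ∀ {n} → (Fin n → Fin n → Bool) → ℕ
edgeCount f = sumFin (λ i → count (λ j → (toℕ i <ᵇ toℕ j) ∧ f i j))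

degree : ∀ {n} → (Fin n → Fin n → Bool) → Fin n → ℕ
degree f i = count (λ j → f i j)

maxDegree : ∀ {n} → (Fin n → Fin n → Bool) → ℕ
maxDegree f = maxFin (degree f)

e : ∀ {n} → Graph n → ℕ
e G = edgeCount (adj G)

record BipartiteSubgraph {n : ℕ} (G : Graph n) : Set where
  field
    X Y      : Subset n
    disjoint : ∀ i → i ∈ X → i ∈ Y → ⊥
    F        : Fin n → Fin n → Bool
    F-sym    : ∀ i j → F i j ≡ F j i
    F-sub    : ∀ i j → F i j ≡ true → adj G i j ≡ true
    F-cross  : ∀ i j → F i j ≡ true → (i ∈ X × j ∈ Y) ⊎ (i ∈ Y × j ∈ X)
open BipartiteSubgraph public

e' : ∀ {n} {G : Graph n} → BipartiteSubgraph G → ℕ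
e' H = edgeCount (F H)

Δ' : ∀ {n} {G : Graph n} → BipartiteSubgraph G → ℕ
Δ' H = maxDegree (F H)

module Submission where

-- Take a cut of G keeping at least half of its edges and sort the vertices
-- into 2 + 2⌊log₂ n⌋ classes by their side of the cut and by ⌊log₂ deg v⌋, ordered so
-- that the two ends of a cut edge always lie in different classes. For a class c let
-- G'_c consist of the cut edges from c down to lower classes, with X = class c and
-- Y = the lower classes; every degree in G'_c is below cap c = 2^(1 + ⌊c/2⌋). If some
-- G'_c has e(G'_c) ≥ |X| cap c / 80 and e(G'_c) ≥ 2 e(G) / (10 log₂ n), it is the
-- required subgraph (|Y| ≤ n). Otherwise the reverse inequalities, summed over all
-- classes together with Σ_c |X_c| cap c = Σ_v 2^(1 + ⌊log₂ deg v⌋) ≤ 4 e(G) + 2n, give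
-- 400 log₂ n · e(G) ≤ 10 log₂ n (4 e(G) + 2n) + 160 e(G) (2 + 2 log₂ n), which fails
-- as soon as the average degree is at least 1024 (then n ≥ 512, so log₂ n ≥ 9).

open import Defs hiding (sym)
open import Data.Nat using (ℕ; _+_; _*_; _^_; _≤_; _<_)
open import Data.Fin.Subset using (∣_∣)
open import Data.Product using (Σ; _×_)

open import Data.Bool using (Bool; true; false; _∧_; _∨_; not; _xor_; if_then_else_; T)
open import Data.Bool.Properties using (T-≡; ∨-zeroʳ; ∨-comm; xor-comm; xor-same)
open import Data.Empty using (⊥-elim)
open import Data.Fin using (Fin; zero; suc; toℕ)
open import Data.Fin.Properties using (toℕ-injective)
open import Data.Fin.Subset using (_∈_)
open import Data.Fin.Subset.Properties using (∣p∣≤n)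
open import Data.List using (_∷_; [])
open import Data.Nat using (zero; suc; z≤n; s≤s; s≤s⁻¹; >-nonZero; _<ᵇ_; _≡ᵇ_; _≤?_; _<?_; ⌊_/2⌋)
open import Data.Nat.Induction using (<-wellFounded)
open import Data.Nat.Logarithm using (⌊log₂_⌋; ⌊log₂⌋-mono-≤; ⌊log₂[2^n]⌋≡n)
open import Data.Nat.Logarithm.Core using (⌊log2⌋)
open import Data.Nat.Properties
open import Data.Nat.Tactic.RingSolver using (solve; solve-∀)
open import Data.Product using (_,_; proj₁; proj₂)
open import Data.Sum using (_⊎_; inj₁; inj₂)
open import Data.Vec using (tabulate)
open import Data.Vec.Properties using (lookup∘tabulate; lookup⇒[]=; []=⇒lookup)
open import Function using (_∘_; Equivalence)
open import Induction.WellFounded using (Acc; acc)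
open import Relation.Binary.Definitions using (tri<; tri≈; tri>)
open import Relation.Binary.PropositionalEquality
open import Relation.Nullary using (¬_; Dec; does; yes; no)

open import Algebra.Properties.CommutativeSemigroup +-commutativeSemigroup using (interchange)
open import Algebra.Properties.Semiring.Sum +-*-semiring using (sum; ∑-comm)

-- Indicators, finite sums and counts

bit : Bool → ℕ
bit b = if b then 1 else 0

bit≤1 : ∀ b → bit b ≤ 1
bit≤1 true  = ≤-refl
bit≤1 false = z≤n

bit-mono : ∀ {a b} → (a ≡ true → b ≡ true) → bit a ≤ bit b
bit-mono {false} _ = z≤n
bit-mono {true}  h rewrite h refl = ≤-refl

bit-cover : ∀ {a b c} → (a ≡ true → b ≡ true ⊎ c ≡ true) → bit a ≤ bit b + bit c
bit-cover {false} _ = z≤n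
bit-cover {true} {b} h with h refl
... | inj₁ refl = s≤s z≤n
... | inj₂ refl = m≤n+m 1 (bit b)

bit*≤ : ∀ b w → bit b * w ≤ w
bit*≤ false w = z≤n
bit*≤ true  w = ≤-reflexive (+-identityʳ w)

∧-true⁻ : ∀ a {b} → a ∧ b ≡ true → a ≡ true × b ≡ true
∧-true⁻ true p = refl , p

∨-true⁻ : ∀ a {b} → a ∨ b ≡ true → a ≡ true ⊎ b ≡ true
∨-true⁻ true  _ = inj₁ refl
∨-true⁻ false p = inj₂ p

≡true⇒T : ∀ {b} → b ≡ true → T b
≡true⇒T = Equivalence.from T-≡

T⇒≡true : ∀ {b} → T b → b ≡ true
T⇒≡true = Equivalence.to T-≡

sumFin-cong : ∀ {n} {f g : Fin n → ℕ} → (∀ i → f i ≡ g i) → sumFin f ≡ sumFin g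
sumFin-cong {zero}  _ = refl
sumFin-cong {suc n} h = cong₂ _+_ (h zero) (sumFin-cong (h ∘ suc))

sumFin-mono : ∀ {n} {f g : Fin n → ℕ} → (∀ i → f i ≤ g i) → sumFin f ≤ sumFin g
sumFin-mono {zero}  _ = z≤n
sumFin-mono {suc n} h = +-mono-≤ (h zero) (sumFin-mono (h ∘ suc))

sumFin-+ : ∀ {n} (f g : Fin n → ℕ) → sumFin (λ i → f i + g i) ≡ sumFin f + sumFin g
sumFin-+ {zero}  f g = refl
sumFin-+ {suc n} f g = trans (cong (f zero + g zero +_) (sumFin-+ (f ∘ suc) (g ∘ suc)))
                             (interchange (f zero) (g zero) _ _)

sumFin-*ˡ : ∀ {n} c (f : Fin n → ℕ) → sumFin (λ i → c * f i) ≡ c * sumFin f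
sumFin-*ˡ {zero}  c f = sym (*-zeroʳ c)
sumFin-*ˡ {suc n} c f = trans (cong (c * f zero +_) (sumFin-*ˡ c (f ∘ suc)))
                              (sym (*-distribˡ-+ c (f zero) _))

sumFin-const : ∀ {n} c → sumFin {n} (λ _ → c) ≡ n * c
sumFin-const {zero}  c = refl
sumFin-const {suc n} c = cong (c +_) (sumFin-const {n} c)

sumFin≡sum : ∀ {n} (f : Fin n → ℕ) → sumFin f ≡ sum f
sumFin≡sum {zero}  f = refl
sumFin≡sum {suc n} f = cong (f zero +_) (sumFin≡sum (f ∘ suc))

sumFin-comm : ∀ {m n} (f : Fin m → Fin n → ℕ) →
  sumFin (λ i → sumFin (f i)) ≡ sumFin (λ j → sumFin (λ i → f i j))
sumFin-comm f = begin
  sumFin (λ i → sumFin (f i))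
    ≡⟨ trans (sumFin-cong (sumFin≡sum ∘ f)) (sumFin≡sum (λ i → sum (f i))) ⟩
  sum (λ i → sum (f i))
    ≡⟨ ∑-comm f ⟩
  sum (λ j → sum (λ i → f i j))
    ≡⟨ trans (sumFin-cong (λ j → sumFin≡sum (λ i → f i j))) (sumFin≡sum (λ j → sum (λ i → f i j))) ⟨
  sumFin (λ j → sumFin (λ i → f i j)) ∎
  where open ≡-Reasoning

count≡sumFin : ∀ {n} (p : Fin n → Bool) → count p ≡ sumFin (bit ∘ p)
count≡sumFin {zero}  p = refl
count≡sumFin {suc n} p = cong (bit (p zero) +_) (count≡sumFin (p ∘ suc))

count≤n : ∀ {n} (p : Fin n → Bool) → count p ≤ n
count≤n {zero}  p = z≤n
count≤n {suc n} p = +-mono-≤ (bit≤1 (p zero)) (count≤n (p ∘ suc))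

count-mono : ∀ {n} {p q : Fin n → Bool} → (∀ i → p i ≡ true → q i ≡ true) → count p ≤ count q
count-mono {zero}  _ = z≤n
count-mono {suc n} h = +-mono-≤ (bit-mono (h zero)) (count-mono (h ∘ suc))

count-cover : ∀ {n} {p q r : Fin n → Bool} → (∀ i → p i ≡ true → q i ≡ true ⊎ r i ≡ true) →
  count p ≤ count q + count r
count-cover {zero}  _ = z≤n
count-cover {suc n} {q = q} {r} h = ≤-trans (+-mono-≤ (bit-cover (h zero)) (count-cover (h ∘ suc)))
  (≤-reflexive (interchange (bit (q zero)) (bit (r zero)) _ _))

count-none : ∀ {n} {p : Fin n → Bool} → (∀ i → ¬ p i ≡ true) → count p ≡ 0
count-none {zero}      _ = refl
count-none {suc n} {p} h with p zero in eq
... | true  = ⊥-elim (h zero eq)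
... | false = count-none (h ∘ suc)

count-weighted : ∀ {n} (p : Fin n → Bool) c → sumFin (λ i → bit (p i) * c) ≡ count p * c
count-weighted {zero}  p c = refl
count-weighted {suc n} p c = trans (cong (bit (p zero) * c +_) (count-weighted (p ∘ suc) c))
                                   (sym (*-distribʳ-+ c (bit (p zero)) _))

∈-tabulate⁻ : ∀ {n} {p : Fin n → Bool} {i} → i ∈ tabulate p → p i ≡ true
∈-tabulate⁻ {p = p} {i} i∈p = trans (sym (lookup∘tabulate p i)) ([]=⇒lookup i∈p)

∈-tabulate⁺ : ∀ {n} {p : Fin n → Bool} {i} → p i ≡ true → i ∈ tabulate p
∈-tabulate⁺ {p = p} {i} pi = lookup⇒[]= i (tabulate p) (trans (lookup∘tabulate p i) pi)

∣tabulate∣ : ∀ {n} (p : Fin n → Bool) → ∣ tabulate p ∣ ≡ count p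
∣tabulate∣ {zero}  p = refl
∣tabulate∣ {suc n} p with p zero
... | true  = cong suc (∣tabulate∣ (p ∘ suc))
... | false = ∣tabulate∣ (p ∘ suc)

maxFin-lub : ∀ {n} {f : Fin n → ℕ} {b} → (∀ i → f i ≤ b) → maxFin f ≤ b
maxFin-lub {zero}  _ = z≤n
maxFin-lub {suc n} h = ⊔-lub (h zero) (maxFin-lub (h ∘ suc))

sumBelow : (ℕ → ℕ) → ℕ → ℕ
sumBelow f zero    = 0
sumBelow f (suc m) = sumBelow f m + f m

sumBelow-*ˡ : ∀ c f m → sumBelow (λ i → c * f i) m ≡ c * sumBelow f m
sumBelow-*ˡ c f zero    = sym (*-zeroʳ c)
sumBelow-*ˡ c f (suc m) = trans (cong (_+ c * f m) (sumBelow-*ˡ c f m)) (sym (*-distribˡ-+ c _ (f m)))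

sumBelow-+ : ∀ f g m → sumBelow (λ i → f i + g i) m ≡ sumBelow f m + sumBelow g m
sumBelow-+ f g zero    = refl
sumBelow-+ f g (suc m) = trans (cong (_+ (f m + g m)) (sumBelow-+ f g m))
                               (interchange (sumBelow f m) (sumBelow g m) (f m) (g m))

sumBelow-const : ∀ c m → sumBelow (λ _ → c) m ≡ m * c
sumBelow-const c zero    = refl
sumBelow-const c (suc m) = trans (cong (_+ c) (sumBelow-const c m)) (+-comm (m * c) c)

sumBelow-mono-or-witness : ∀ {P : ℕ → Set} {f g : ℕ → ℕ} → (∀ i → P i ⊎ f i ≤ g i) →
  ∀ m → Σ ℕ P ⊎ sumBelow f m ≤ sumBelow g m
sumBelow-mono-or-witness h zero = inj₂ z≤n
sumBelow-mono-or-witness h (suc m) with sumBelow-mono-or-witness h m | h m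
... | inj₁ w  | _       = inj₁ w
... | inj₂ _  | inj₁ pm = inj₁ (m , pm)
... | inj₂ ≤m | inj₂ ≤  = inj₂ (+-mono-≤ ≤m ≤)

edgeCount-mono : ∀ {n} {f g : Fin n → Fin n → Bool} → (∀ i j → f i j ≡ true → g i j ≡ true) →
  edgeCount f ≤ edgeCount g
edgeCount-mono h = sumFin-mono λ i → count-mono λ j → ∧-mapʳ (toℕ i <ᵇ toℕ j) (h i j)
  where
  ∧-mapʳ : ∀ a {b c} → (b ≡ true → c ≡ true) → a ∧ b ≡ true → a ∧ c ≡ true
  ∧-mapʳ true h = h

edgeCount-cover : ∀ {n} {f g r : Fin n → Fin n → Bool} →
  (∀ i j → f i j ≡ true → g i j ≡ true ⊎ r i j ≡ true) →
  edgeCount f ≤ edgeCount g + edgeCount r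
edgeCount-cover {g = g} {r} h =
  ≤-trans (sumFin-mono λ i → count-cover λ j → ∧-coverʳ (toℕ i <ᵇ toℕ j) (h i j))
          (≤-reflexive (sumFin-+ (λ i → count (λ j → (toℕ i <ᵇ toℕ j) ∧ g i j))
                                 (λ i → count (λ j → (toℕ i <ᵇ toℕ j) ∧ r i j))))
  where
  ∧-coverʳ : ∀ a {b c d} → (b ≡ true → c ≡ true ⊎ d ≡ true) →
             a ∧ b ≡ true → a ∧ c ≡ true ⊎ a ∧ d ≡ true
  ∧-coverʳ true h = h

edgeCount-none : ∀ {n} {f : Fin n → Fin n → Bool} → (∀ i j → ¬ f i j ≡ true) → edgeCount f ≡ 0
edgeCount-none {n} {f} h =
  trans (sumFin-cong λ i → count-none λ j → h i j ∘ proj₂ ∘ ∧-true⁻ (toℕ i <ᵇ toℕ j))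
        (trans (sumFin-const {n} 0) (*-zeroʳ n))

edgeCount≤n*n : ∀ {n} (f : Fin n → Fin n → Bool) → edgeCount f ≤ n * n
edgeCount≤n*n {n} f = ≤-trans (sumFin-mono λ i → count≤n (λ j → (toℕ i <ᵇ toℕ j) ∧ f i j))
                              (≤-reflexive (sumFin-const {n} n))

handshake : ∀ {n} (f : Fin n → Fin n → Bool) → (∀ i j → f i j ≡ f j i) → (∀ i → f i i ≡ false) →
  sumFin (degree f) ≤ 2 * edgeCount f
handshake {n} f f-sym f-irrefl = begin
  sumFin (degree f)                ≤⟨ sumFin-mono (λ i → count-cover (split i)) ⟩
  sumFin (λ i → up i + down i)     ≡⟨ sumFin-+ up down ⟩
  edgeCount f + sumFin down        ≡⟨ cong (edgeCount f +_) down≡up ⟩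
  edgeCount f + edgeCount f        ≡⟨ cong (edgeCount f +_) (+-identityʳ _) ⟨
  2 * edgeCount f                  ∎
  where
  open ≤-Reasoning
  up down : Fin n → ℕ
  up i   = count (λ j → (toℕ i <ᵇ toℕ j) ∧ f i j)
  down i = count (λ j → (toℕ j <ᵇ toℕ i) ∧ f i j)
  split : ∀ i j → f i j ≡ true →
          (toℕ i <ᵇ toℕ j) ∧ f i j ≡ true ⊎ (toℕ j <ᵇ toℕ i) ∧ f i j ≡ true
  split i j fij with <-cmp (toℕ i) (toℕ j)
  ... | tri< i<j _ _ rewrite T⇒≡true (<⇒<ᵇ i<j) = inj₁ fij
  ... | tri> _ _ j<i rewrite T⇒≡true (<⇒<ᵇ j<i) = inj₂ fij
  ... | tri≈ _ i≡j _ with toℕ-injective i≡j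
  ...   | refl with trans (sym fij) (f-irrefl i)
  ...     | ()
  down≡up : sumFin down ≡ edgeCount f
  down≡up = begin-equality
    sumFin down
      ≡⟨ sumFin-cong (λ i → count≡sumFin (λ j → (toℕ j <ᵇ toℕ i) ∧ f i j)) ⟩
    sumFin (λ i → sumFin (λ j → bit ((toℕ j <ᵇ toℕ i) ∧ f i j)))
      ≡⟨ sumFin-comm (λ i j → bit ((toℕ j <ᵇ toℕ i) ∧ f i j)) ⟩
    sumFin (λ j → sumFin (λ i → bit ((toℕ j <ᵇ toℕ i) ∧ f i j)))
      ≡⟨ sumFin-cong (λ j → sumFin-cong (λ i → cong (λ b → bit ((toℕ j <ᵇ toℕ i) ∧ b)) (f-sym i j))) ⟩
    sumFin (λ j → sumFin (λ i → bit ((toℕ j <ᵇ toℕ i) ∧ f j i)))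
      ≡⟨ sumFin-cong (λ j → count≡sumFin (λ i → (toℕ j <ᵇ toℕ i) ∧ f j i)) ⟨
    edgeCount f ∎

-- A large cut

cut : ∀ {m} → (Fin m → Fin m → Bool) → (Fin m → Bool) → Fin m → Fin m → Bool
cut A side i j = A i j ∧ (side i xor side j)

minoritySide : ∀ {m} → (neighbour side : Fin m → Bool) → Bool
minoritySide nbr side = does (count (λ j → nbr j ∧ side j) ≤? count (λ j → nbr j ∧ not (side j)))

count≤2*count-minoritySide : ∀ {m} (p side : Fin m → Bool) →
  count p ≤ 2 * count (λ j → p j ∧ (minoritySide p side xor side j))
count≤2*count-minoritySide p side = pick (onTrue ≤? onFalse)
  where
  onTrue onFalse : ℕ
  onTrue  = count (λ j → p j ∧ side j)
  onFalse = count (λ j → p j ∧ not (side j))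
  split : ∀ j → p j ≡ true → p j ∧ side j ≡ true ⊎ p j ∧ not (side j) ≡ true
  split j pj rewrite pj with side j
  ... | true  = inj₁ refl
  ... | false = inj₂ refl
  n+n≡2*n : ∀ x → x + x ≡ 2 * x
  n+n≡2*n x = cong (x +_) (sym (+-identityʳ x))
  pick : (d : Dec (onTrue ≤ onFalse)) → count p ≤ 2 * count (λ j → p j ∧ (does d xor side j))
  pick (yes t≤f) = ≤-trans (count-cover split)
                     (≤-trans (+-monoˡ-≤ onFalse t≤f) (≤-reflexive (n+n≡2*n onFalse)))
  pick (no t≰f)  = ≤-trans (count-cover split)
                     (≤-trans (+-monoʳ-≤ onTrue (<⇒≤ (≰⇒> t≰f))) (≤-reflexive (n+n≡2*n onTrue)))

-- Vertex zero is placed last, opposite the majority of its neighbours, so that at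
-- least half of its edges are cut.
greedySide : ∀ {m} → (Fin m → Fin m → Bool) → Fin m → Bool
greedySide {suc m} A zero    = minoritySide (λ j → A zero (suc j)) (greedySide (λ i j → A (suc i) (suc j)))
greedySide {suc m} A (suc i) = greedySide (λ i j → A (suc i) (suc j)) i

edgeCount≤2*cut-greedy : ∀ {m} (A : Fin m → Fin m → Bool) → edgeCount A ≤ 2 * edgeCount (cut A (greedySide A))
edgeCount≤2*cut-greedy {zero}  A = z≤n
edgeCount≤2*cut-greedy {suc m} A =
  ≤-trans (+-mono-≤ (count≤2*count-minoritySide (λ j → A zero (suc j)) (greedySide A′))
                    (edgeCount≤2*cut-greedy A′))
          (≤-reflexive (sym (*-distribˡ-+ 2 (count (λ j → cut A (greedySide A) zero (suc j)))
                                              (edgeCount (cut A′ (greedySide A′))))))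
  where
  A′ = λ i j → A (suc i) (suc j)

-- Binary logarithm

2*⌊n/2⌋≤n : ∀ n → 2 * ⌊ n /2⌋ ≤ n
2*⌊n/2⌋≤n zero          = z≤n
2*⌊n/2⌋≤n (suc zero)    = z≤n
2*⌊n/2⌋≤n (suc (suc n)) = ≤-trans (≤-reflexive (*-suc 2 ⌊ n /2⌋)) (s≤s (s≤s (2*⌊n/2⌋≤n n)))

n<2+2*⌊n/2⌋ : ∀ n → n < 2 + 2 * ⌊ n /2⌋
n<2+2*⌊n/2⌋ zero          = s≤s z≤n
n<2+2*⌊n/2⌋ (suc zero)    = s≤s (s≤s z≤n)
n<2+2*⌊n/2⌋ (suc (suc n)) = ≤-trans (s≤s (s≤s (n<2+2*⌊n/2⌋ n)))
                                    (≤-reflexive (cong (2 +_) (sym (*-suc 2 ⌊ n /2⌋))))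

2^⌊log₂n⌋≤n : ∀ {n} → 1 ≤ n → 2 ^ ⌊log₂ n ⌋ ≤ n
2^⌊log₂n⌋≤n {n} = go n (<-wellFounded n)
  where
  go : ∀ n (rec : Acc _<_ n) → 1 ≤ n → 2 ^ ⌊log2⌋ n rec ≤ n
  go (suc zero)    _       _ = ≤-refl
  go (suc (suc n)) (acc _) _ = begin
    2 * 2 ^ ⌊log2⌋ (suc ⌊ n /2⌋) _ ≤⟨ *-monoʳ-≤ 2 (go (suc ⌊ n /2⌋) _ (s≤s z≤n)) ⟩
    2 * suc ⌊ n /2⌋               ≤⟨ 2*⌊n/2⌋≤n (suc (suc n)) ⟩
    suc (suc n)                   ∎
    where open ≤-Reasoning

n<2^suc⌊log₂n⌋ : ∀ n → n < 2 ^ suc ⌊log₂ n ⌋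
n<2^suc⌊log₂n⌋ n = go n (<-wellFounded n)
  where
  go : ∀ n (rec : Acc _<_ n) → n < 2 ^ suc (⌊log2⌋ n rec)
  go zero          _        = s≤s z≤n
  go (suc zero)    _        = s≤s (s≤s z≤n)
  go (suc (suc n)) (acc _) = begin-strict
    suc (suc n)                       <⟨ n<2+2*⌊n/2⌋ (suc (suc n)) ⟩
    2 + 2 * suc ⌊ n /2⌋               ≡⟨ *-suc 2 (suc ⌊ n /2⌋) ⟨
    2 * suc (suc ⌊ n /2⌋)             ≤⟨ *-monoʳ-≤ 2 (go (suc ⌊ n /2⌋) _) ⟩
    2 * 2 ^ suc (⌊log2⌋ (suc ⌊ n /2⌋) _) ∎
    where open ≤-Reasoning

2^suc⌊log₂n⌋≤2n+2 : ∀ n → 2 ^ suc ⌊log₂ n ⌋ ≤ 2 * n + 2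
2^suc⌊log₂n⌋≤2n+2 zero    = ≤-refl
2^suc⌊log₂n⌋≤2n+2 (suc n) = ≤-trans (*-monoʳ-≤ 2 (2^⌊log₂n⌋≤n (s≤s z≤n))) (m≤m+n (2 * suc n) 2)

-- layer b ℓ = 2ℓ + bit b, so the two ends of a cut edge never share a layer.
layer : Bool → ℕ → ℕ
layer b zero    = bit b
layer b (suc ℓ) = suc (suc (layer b ℓ))

⌊layer/2⌋≡level : ∀ b ℓ → ⌊ layer b ℓ /2⌋ ≡ ℓ
⌊layer/2⌋≡level false zero    = refl
⌊layer/2⌋≡level true  zero    = refl
⌊layer/2⌋≡level b     (suc ℓ) = cong suc (⌊layer/2⌋≡level b ℓ)

layer-injectiveˡ : ∀ {a b} ℓ m → layer a ℓ ≡ layer b m → a ≡ b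
layer-injectiveˡ {false} {false} zero    zero    _  = refl
layer-injectiveˡ {true}  {true}  zero    zero    _  = refl
layer-injectiveˡ {false} {true}  zero    zero    ()
layer-injectiveˡ {true}  {false} zero    zero    ()
layer-injectiveˡ {false}         zero    (suc m) ()
layer-injectiveˡ {true}          zero    (suc m) ()
layer-injectiveˡ {_} {false} (suc ℓ) zero    ()
layer-injectiveˡ {_} {true}  (suc ℓ) zero    ()
layer-injectiveˡ                 (suc ℓ) (suc m) eq = layer-injectiveˡ ℓ m (suc-injective (suc-injective eq))

layer≤1+2*level : ∀ b ℓ → layer b ℓ ≤ 1 + 2 * ℓ
layer≤1+2*level b zero    = bit≤1 b
layer≤1+2*level b (suc ℓ) = ≤-trans (s≤s (s≤s (layer≤1+2*level b ℓ)))
                                    (≤-reflexive (cong suc (sym (*-suc 2 ℓ))))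

bit-<ᵇ-suc : ∀ a m → bit (a <ᵇ suc m) ≡ bit (a <ᵇ m) + bit (a ≡ᵇ m)
bit-<ᵇ-suc zero    zero    = refl
bit-<ᵇ-suc zero    (suc m) = refl
bit-<ᵇ-suc (suc a) zero    = refl
bit-<ᵇ-suc (suc a) (suc m) = bit-<ᵇ-suc a m

descends : ℕ → ℕ → ℕ → Bool
descends c a b = (a ≡ᵇ c) ∧ (b <ᵇ c)

descends⁺ : ∀ {c a b} → a ≡ c → b < c → descends c a b ≡ true
descends⁺ {c} {a} a≡c b<c rewrite T⇒≡true (≡⇒≡ᵇ a c a≡c) = T⇒≡true (<⇒<ᵇ b<c)

descends⁻ : ∀ {c a b} → descends c a b ≡ true → a ≡ c × b < c
descends⁻ {c} {a} {b} d with ∧-true⁻ (a ≡ᵇ c) d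
... | a≡c , b<c = ≡ᵇ⇒≡ a c (≡true⇒T a≡c) , <ᵇ⇒< b c (≡true⇒T b<c)

below-suc-cover : ∀ {a b m} → a ≢ b → (a <ᵇ suc m) ∧ (b <ᵇ suc m) ≡ true →
  (a <ᵇ m) ∧ (b <ᵇ m) ≡ true ⊎ descends m a b ∨ descends m b a ≡ true
below-suc-cover {a} {b} {m} a≢b below with ∧-true⁻ (a <ᵇ suc m) below
... | a<1+m , b<1+m with a <? m | b <? m
...   | yes a<m | yes b<m rewrite T⇒≡true (<⇒<ᵇ a<m) = inj₁ (T⇒≡true (<⇒<ᵇ b<m))
...   | no a≮m  | _       = inj₂ (cong (_∨ descends m b a) (descends⁺ a≡m b<m))
  where
  a≡m = ≤-antisym (s≤s⁻¹ (<ᵇ⇒< a (suc m) (≡true⇒T a<1+m))) (≮⇒≥ a≮m)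
  b<m = ≤∧≢⇒< (s≤s⁻¹ (<ᵇ⇒< b (suc m) (≡true⇒T b<1+m))) (λ b≡m → a≢b (trans a≡m (sym b≡m)))
...   | yes a<m | no b≮m  = inj₂ (trans (cong (descends m a b ∨_) (descends⁺ b≡m a<m)) (∨-zeroʳ _))
  where
  b≡m = ≤-antisym (s≤s⁻¹ (<ᵇ⇒< b (suc m) (≡true⇒T b<1+m))) (≮⇒≥ b≮m)

-- With 20 n ≤ e the bound reduces to 39 K e ≤ 320 e, which fails for K ≥ 9.
sparse-bound-impossible : ∀ {K e n} → 9 ≤ K → 1 ≤ e → 1024 * n ≤ 2 * e →
  ¬ 400 * K * e ≤ 10 * K * (2 * (2 * e) + n * 2) + 160 * e * (2 + 2 * K)
sparse-bound-impossible {K} {e} {n} 9≤K 1≤e 1024n≤2e bound = <⇒≱ 320e<351e (begin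
  351 * e     ≤⟨ *-monoˡ-≤ e (*-monoʳ-≤ 39 9≤K) ⟩
  39 * K * e  ≤⟨ +-cancelʳ-≤ (361 * K * e) (39 * K * e) (320 * e) (begin
    39 * K * e + 361 * K * e                 ≡⟨ solve (K ∷ e ∷ n ∷ []) ⟩
    400 * K * e                              ≤⟨ bound ⟩
    10 * K * (2 * (2 * e) + n * 2) + 160 * e * (2 + 2 * K) ≡⟨ solve (K ∷ e ∷ n ∷ []) ⟩
    360 * K * e + 320 * e + K * (20 * n)     ≤⟨ +-monoʳ-≤ (360 * K * e + 320 * e) (*-monoʳ-≤ K 20n≤e) ⟩
    360 * K * e + 320 * e + K * e            ≡⟨ solve (K ∷ e ∷ n ∷ []) ⟩
    320 * e + 361 * K * e                    ∎) ⟩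
  320 * e     ∎)
  where
  open ≤-Reasoning
  320e<351e : 320 * e < 351 * e
  320e<351e = *-monoˡ-< e {{>-nonZero 1≤e}} {320} {351} (m≤m+n 321 30)
  20n≤e : 20 * n ≤ e
  20n≤e = *-cancelˡ-≤ 2 (begin
    2 * (20 * n) ≡⟨ solve (n ∷ []) ⟩
    40 * n       ≤⟨ *-monoˡ-≤ n (m≤m+n 40 984) ⟩
    1024 * n     ≤⟨ 1024n≤2e ⟩
    2 * e        ∎)

1024n≤2e⇒1≤e : ∀ {n e} → 0 < n → 1024 * n ≤ 2 * e → 1 ≤ e
1024n≤2e⇒1≤e 0<n 1024n≤2e =
  *-cancelˡ-≤ 2 (≤-trans (m≤m+n 2 1022) (≤-trans (*-monoʳ-≤ 1024 0<n) 1024n≤2e))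

2^a≤n^b : ∀ {K n a b} → 2 ^ K ≤ n → a ≤ K * b → 2 ^ a ≤ n ^ b
2^a≤n^b {K} {n} {a} {b} 2^K≤n a≤Kb = begin
  2 ^ a       ≤⟨ ^-monoʳ-≤ 2 a≤Kb ⟩
  2 ^ (K * b) ≡⟨ ^-*-assoc 2 K b ⟨
  (2 ^ K) ^ b ≤⟨ ^-monoˡ-≤ b 2^K≤n ⟩
  n ^ b       ∎
  where open ≤-Reasoning

-- The layered parts of a large cut

module Layering {n} (G : Graph n) where

  side : Fin n → Bool
  side = greedySide (adj G)

  cutEdge : Fin n → Fin n → Bool
  cutEdge = cut (adj G) side

  level : Fin n → ℕ
  level v = ⌊log₂ degree (adj G) v ⌋

  class : Fin n → ℕ
  class v = layer (side v) (level v)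

  log₂n : ℕ
  log₂n = ⌊log₂ n ⌋

  classes : ℕ
  classes = 2 + 2 * log₂n

  class<classes : ∀ v → class v < classes
  class<classes v = s≤s (≤-trans (layer≤1+2*level (side v) (level v))
                                 (s≤s (*-monoʳ-≤ 2 (⌊log₂⌋-mono-≤ (count≤n (adj G v))))))

  cutEdge-class≢ : ∀ {u v} → cutEdge u v ≡ true → class u ≢ class v
  cutEdge-class≢ {u} {v} huv eq with trans (sym sides-differ) sides-agree
    where
    sides-differ : side u xor side v ≡ true
    sides-differ = proj₂ (∧-true⁻ (adj G u v) huv)
    sides-agree : side u xor side v ≡ false
    sides-agree = trans (cong (_xor side v) (layer-injectiveˡ (level u) (level v) eq)) (xor-same (side v))
  ... | ()

  straddles : ℕ → Fin n → Fin n → Bool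
  straddles c u v = descends c (class u) (class v) ∨ descends c (class v) (class u)

  partEdge : ℕ → Fin n → Fin n → Bool
  partEdge c u v = straddles c u v ∧ cutEdge u v

  partEdge⇒class≤ : ∀ {c u v} → partEdge c u v ≡ true → class u ≤ c
  partEdge⇒class≤ {c} {u} {v} p
    with ∨-true⁻ (descends c (class u) (class v)) (proj₁ (∧-true⁻ (straddles c u v) p))
  ... | inj₁ d = ≤-reflexive (proj₁ (descends⁻ {c} {class u} {class v} d))
  ... | inj₂ d = <⇒≤ (proj₂ (descends⁻ {c} {class v} {class u} d))

  partEdge⇒adj : ∀ {c u v} → partEdge c u v ≡ true → adj G u v ≡ true
  partEdge⇒adj {c} {u} {v} p = proj₁ (∧-true⁻ (adj G u v) (proj₂ (∧-true⁻ (straddles c u v) p)))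

  part : ℕ → BipartiteSubgraph G
  part c = record
    { X        = tabulate (λ v → class v ≡ᵇ c)
    ; Y        = tabulate (λ v → class v <ᵇ c)
    ; disjoint = λ v v∈X v∈Y → <-irrefl (≡ᵇ⇒≡ (class v) c (≡true⇒T (∈-tabulate⁻ v∈X)))
                                        (<ᵇ⇒< (class v) c (≡true⇒T (∈-tabulate⁻ v∈Y)))
    ; F        = partEdge c
    ; F-sym    = λ u v → cong₂ _∧_ (∨-comm (descends c (class u) (class v)) _)
                                   (cong₂ _∧_ (Graph.sym G u v) (xor-comm (side u) (side v)))
    ; F-sub    = λ u v → partEdge⇒adj
    ; F-cross  = cross
    }
    where
    cross : ∀ u v → partEdge c u v ≡ true →
      (u ∈ tabulate (λ w → class w ≡ᵇ c) × v ∈ tabulate (λ w → class w <ᵇ c)) ⊎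
      (u ∈ tabulate (λ w → class w <ᵇ c) × v ∈ tabulate (λ w → class w ≡ᵇ c))
    cross u v p with ∨-true⁻ (descends c (class u) (class v)) (proj₁ (∧-true⁻ (straddles c u v) p))
    ... | inj₁ d = let (u≡c , v<c) = ∧-true⁻ (class u ≡ᵇ c) d
                   in inj₁ (∈-tabulate⁺ u≡c , ∈-tabulate⁺ v<c)
    ... | inj₂ d = let (v≡c , u<c) = ∧-true⁻ (class v ≡ᵇ c) d
                   in inj₂ (∈-tabulate⁺ u<c , ∈-tabulate⁺ v≡c)

  cap : ℕ → ℕ
  cap c = 2 ^ suc ⌊ c /2⌋

  size : ℕ → ℕ
  size c = count (λ v → class v ≡ᵇ c)

  weight : Fin n → ℕ
  weight v = 2 ^ suc (level v)

  ⌊class/2⌋≡level : ∀ v → ⌊ class v /2⌋ ≡ level v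
  ⌊class/2⌋≡level v = ⌊layer/2⌋≡level (side v) (level v)

  degree-partEdge≤cap : ∀ c v → degree (partEdge c) v ≤ cap c
  degree-partEdge≤cap c v with class v ≤? c
  ... | no  v≰c = ≤-trans (≤-reflexive (count-none (λ u → v≰c ∘ partEdge⇒class≤ {c} {v} {u}))) z≤n
  ... | yes v≤c = begin
    degree (partEdge c) v    ≤⟨ count-mono (λ u → partEdge⇒adj {c} {v} {u}) ⟩
    degree (adj G) v         ≤⟨ <⇒≤ (n<2^suc⌊log₂n⌋ _) ⟩
    weight v                 ≡⟨ cong (λ ℓ → 2 ^ suc ℓ) (⌊class/2⌋≡level v) ⟨
    2 ^ suc ⌊ class v /2⌋    ≤⟨ ^-monoʳ-≤ 2 (s≤s (⌊n/2⌋-mono v≤c)) ⟩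
    cap c                    ∎
    where open ≤-Reasoning

  lowerEdges : ℕ → Fin n → Fin n → Bool
  lowerEdges m u v = ((class u <ᵇ m) ∧ (class v <ᵇ m)) ∧ cutEdge u v

  edgeCount-lowerEdges : ∀ m → edgeCount (lowerEdges m) ≤ sumBelow (λ c → e' (part c)) m
  edgeCount-lowerEdges zero    = ≤-reflexive (edgeCount-none {f = lowerEdges zero} λ u v ())
  edgeCount-lowerEdges (suc m) = ≤-trans (edgeCount-cover split) (+-monoˡ-≤ _ (edgeCount-lowerEdges m))
    where
    split : ∀ u v → lowerEdges (suc m) u v ≡ true → lowerEdges m u v ≡ true ⊎ partEdge m u v ≡ true
    split u v p with ∧-true⁻ ((class u <ᵇ suc m) ∧ (class v <ᵇ suc m)) p
    ... | below , huv with below-suc-cover (cutEdge-class≢ huv) below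
    ...   | inj₁ below′ = inj₁ (cong₂ _∧_ below′ huv)
    ...   | inj₂ strad  = inj₂ (cong₂ _∧_ strad huv)

  edgeCount-cutEdge≤∑e' : edgeCount cutEdge ≤ sumBelow (λ c → e' (part c)) classes
  edgeCount-cutEdge≤∑e' = ≤-trans (edgeCount-mono lower) (edgeCount-lowerEdges classes)
    where
    lower : ∀ u v → cutEdge u v ≡ true → lowerEdges classes u v ≡ true
    lower u v huv = cong₂ _∧_ (cong₂ _∧_ (below u) (below v)) huv
      where
      below : ∀ w → (class w <ᵇ classes) ≡ true
      below w = T⇒≡true (<⇒<ᵇ (class<classes w))

  weightBelow : ℕ → ℕ
  weightBelow m = sumFin (λ v → bit (class v <ᵇ m) * weight v)

  weight-in-class : ∀ c v → bit (class v ≡ᵇ c) * weight v ≡ bit (class v ≡ᵇ c) * cap c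
  weight-in-class c v with class v ≡ᵇ c in eq
  ... | false = refl
  ... | true  = cong (λ ℓ → 1 * 2 ^ suc ℓ)
                     (trans (sym (⌊class/2⌋≡level v)) (cong ⌊_/2⌋ (≡ᵇ⇒≡ (class v) c (≡true⇒T eq))))

  ∑size*cap≡weightBelow : ∀ m → sumBelow (λ c → size c * cap c) m ≡ weightBelow m
  ∑size*cap≡weightBelow zero    = sym (trans (sumFin-const {n} 0) (*-zeroʳ n))
  ∑size*cap≡weightBelow (suc m) = begin
    sumBelow (λ c → size c * cap c) m + size m * cap m
      ≡⟨ cong (_+ size m * cap m) (∑size*cap≡weightBelow m) ⟩
    weightBelow m + size m * cap m
      ≡⟨ cong (weightBelow m +_) (trans (sumFin-cong (weight-in-class m))
                                        (count-weighted (λ v → class v ≡ᵇ m) (cap m))) ⟨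
    weightBelow m + sumFin (λ v → bit (class v ≡ᵇ m) * weight v)
      ≡⟨ sumFin-+ (λ v → bit (class v <ᵇ m) * weight v) (λ v → bit (class v ≡ᵇ m) * weight v) ⟨
    sumFin (λ v → bit (class v <ᵇ m) * weight v + bit (class v ≡ᵇ m) * weight v)
      ≡⟨ sumFin-cong (λ v → trans (cong (_* weight v) (bit-<ᵇ-suc (class v) m))
                                   (*-distribʳ-+ (weight v) (bit (class v <ᵇ m)) (bit (class v ≡ᵇ m)))) ⟨
    weightBelow (suc m) ∎
    where open ≡-Reasoning

  weightBelow≤ : ∀ m → weightBelow m ≤ 2 * (2 * e G) + n * 2
  weightBelow≤ m = begin
    weightBelow m                            ≤⟨ sumFin-mono (λ v → bit*≤ (class v <ᵇ m) (weight v)) ⟩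
    sumFin weight                            ≤⟨ sumFin-mono (λ v → 2^suc⌊log₂n⌋≤2n+2 (degree (adj G) v)) ⟩
    sumFin (λ v → 2 * degree (adj G) v + 2)  ≡⟨ sumFin-+ (λ v → 2 * degree (adj G) v) (λ _ → 2) ⟩
    sumFin (λ v → 2 * degree (adj G) v) + sumFin {n} (λ _ → 2)
      ≡⟨ cong₂ _+_ (sumFin-*ˡ 2 (degree (adj G))) (sumFin-const {n} 2) ⟩
    2 * sumFin (degree (adj G)) + n * 2
      ≤⟨ +-monoˡ-≤ (n * 2) (*-monoʳ-≤ 2 (handshake (adj G) (Graph.sym G) (irrefl G))) ⟩
    2 * (2 * e G) + n * 2                    ∎
    where open ≤-Reasoning

  -- The two bounds of the theorem for part c, as Δ' (part c) ≤ cap c, ∣ X ∣ = size c and ∣ Y ∣ ≤ n.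
  Balanced Dense : ℕ → Set
  Balanced c = size c * cap c ≤ 80 * e' (part c)
  Dense    c = 2 * e G ≤ 10 * log₂n * e' (part c)

  balanced-dense-or-bounded : ∀ c → Balanced c × Dense c ⊎
    800 * log₂n * e' (part c) ≤ 10 * log₂n * (size c * cap c) + 160 * e G
  balanced-dense-or-bounded c with size c * cap c ≤? 80 * e' (part c) | 2 * e G ≤? 10 * log₂n * e' (part c)
  ... | yes balanced  | yes dense = inj₁ (balanced , dense)
  ... | no unbalanced | _         = inj₂ (begin
    800 * log₂n * e' (part c)      ≡⟨ 800kf≡10k[80f] log₂n (e' (part c)) ⟩
    10 * log₂n * (80 * e' (part c)) ≤⟨ *-monoʳ-≤ (10 * log₂n) (<⇒≤ (≰⇒> unbalanced)) ⟩
    10 * log₂n * (size c * cap c)  ≤⟨ m≤m+n (10 * log₂n * (size c * cap c)) (160 * e G) ⟩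
    10 * log₂n * (size c * cap c) + 160 * e G ∎)
    where
    open ≤-Reasoning
    800kf≡10k[80f] : ∀ k f → 800 * k * f ≡ 10 * k * (80 * f)
    800kf≡10k[80f] = solve-∀
  ... | yes _         | no sparse = inj₂ (begin
    800 * log₂n * e' (part c)      ≡⟨ 800kf≡80[10kf] log₂n (e' (part c)) ⟩
    80 * (10 * log₂n * e' (part c)) ≤⟨ *-monoʳ-≤ 80 (<⇒≤ (≰⇒> sparse)) ⟩
    80 * (2 * e G)                 ≡⟨ *-assoc 80 2 (e G) ⟨
    160 * e G                      ≤⟨ m≤n+m (160 * e G) (10 * log₂n * (size c * cap c)) ⟩
    10 * log₂n * (size c * cap c) + 160 * e G ∎)
    where
    open ≤-Reasoning
    800kf≡80[10kf] : ∀ k f → 800 * k * f ≡ 80 * (10 * k * f)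
    800kf≡80[10kf] = solve-∀

  balanced-dense-or-sparse : Σ ℕ (λ c → Balanced c × Dense c) ⊎
    400 * log₂n * e G ≤ 10 * log₂n * (2 * (2 * e G) + n * 2) + 160 * e G * classes
  balanced-dense-or-sparse with sumBelow-mono-or-witness balanced-dense-or-bounded classes
  ... | inj₁ balanced-dense = inj₁ balanced-dense
  ... | inj₂ ∑≤∑ = inj₂ (begin
    400 * log₂n * e G                    ≤⟨ *-monoʳ-≤ (400 * log₂n) (edgeCount≤2*cut-greedy (adj G)) ⟩
    400 * log₂n * (2 * edgeCount cutEdge) ≡⟨ 400k[2h]≡800kh log₂n (edgeCount cutEdge) ⟩
    800 * log₂n * edgeCount cutEdge      ≤⟨ *-monoʳ-≤ (800 * log₂n) edgeCount-cutEdge≤∑e' ⟩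
    800 * log₂n * sumBelow (λ c → e' (part c)) classes
      ≡⟨ sumBelow-*ˡ (800 * log₂n) (λ c → e' (part c)) classes ⟨
    sumBelow (λ c → 800 * log₂n * e' (part c)) classes
      ≤⟨ ∑≤∑ ⟩
    sumBelow (λ c → 10 * log₂n * (size c * cap c) + 160 * e G) classes
      ≡⟨ sumBelow-+ (λ c → 10 * log₂n * (size c * cap c)) (λ _ → 160 * e G) classes ⟩
    sumBelow (λ c → 10 * log₂n * (size c * cap c)) classes + sumBelow (λ _ → 160 * e G) classes
      ≡⟨ cong₂ _+_ (sumBelow-*ˡ (10 * log₂n) (λ c → size c * cap c) classes)
                   (sumBelow-const (160 * e G) classes) ⟩
    10 * log₂n * sumBelow (λ c → size c * cap c) classes + classes * (160 * e G)
      ≤⟨ +-mono-≤ (*-monoʳ-≤ (10 * log₂n) (≤-trans (≤-reflexive (∑size*cap≡weightBelow classes))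
                                                    (weightBelow≤ classes)))
                  (≤-reflexive (*-comm classes (160 * e G))) ⟩
    10 * log₂n * (2 * (2 * e G) + n * 2) + 160 * e G * classes ∎)
    where
    open ≤-Reasoning
    400k[2h]≡800kh : ∀ k h → 400 * k * (2 * h) ≡ 800 * k * h
    400k[2h]≡800kh = solve-∀

  balanced-dense-part : 0 < n → 1024 * n ≤ 2 * e G → Σ ℕ λ c → Balanced c × Dense c
  balanced-dense-part 0<n 1024n≤2e with balanced-dense-or-sparse
  ... | inj₁ balanced-dense = balanced-dense
  ... | inj₂ sparse         =
    ⊥-elim (sparse-bound-impossible {log₂n} {e G} {n} 9≤log₂n (1024n≤2e⇒1≤e 0<n 1024n≤2e) 1024n≤2e sparse)
    where
    open ≤-Reasoning
    512≤n : 512 ≤ n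
    512≤n = *-cancelʳ-≤ 512 n n {{>-nonZero 0<n}} (*-cancelˡ-≤ 2 (begin
      2 * (512 * n) ≡⟨ *-assoc 2 512 n ⟨
      1024 * n      ≤⟨ 1024n≤2e ⟩
      2 * e G       ≤⟨ *-monoʳ-≤ 2 (edgeCount≤n*n (adj G)) ⟩
      2 * (n * n)   ∎))
    9≤log₂n : 9 ≤ log₂n
    9≤log₂n = subst (_≤ log₂n) (⌊log₂[2^n]⌋≡n 9) (⌊log₂⌋-mono-≤ 512≤n)

  bounded-part : 0 < n → 1024 * n ≤ 2 * e G → Σ (BipartiteSubgraph G) λ G′ →
      (1 ≤ e' G′)
    × (∣ X G′ ∣ * Δ' G′ ≤ 80 * e' G′)
    × (2 ^ (∣ Y G′ ∣ * (2 * e G)) ≤ n ^ (10 * n * e' G′))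
  bounded-part 0<n 1024n≤2e with balanced-dense-part 0<n 1024n≤2e
  ... | c , balanced , dense = part c , 1≤e' , X-bound , Y-bound
    where
    open ≤-Reasoning
    1≤e' : 1 ≤ e' (part c)
    1≤e' = n≢0⇒n>0 λ e'≡0 → n≮0 (begin-strict
      1                        <⟨ *-monoʳ-≤ 2 (1024n≤2e⇒1≤e {n} {e G} 0<n 1024n≤2e) ⟩
      2 * e G                  ≤⟨ dense ⟩
      10 * log₂n * e' (part c) ≡⟨ trans (cong (10 * log₂n *_) e'≡0) (*-zeroʳ (10 * log₂n)) ⟩
      0                        ∎)
    X-bound : ∣ X (part c) ∣ * Δ' (part c) ≤ 80 * e' (part c)
    X-bound = begin
      ∣ X (part c) ∣ * Δ' (part c) ≡⟨ cong (_* Δ' (part c)) (∣tabulate∣ (λ v → class v ≡ᵇ c)) ⟩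
      size c * Δ' (part c)         ≤⟨ *-monoʳ-≤ (size c) (maxFin-lub (degree-partEdge≤cap c)) ⟩
      size c * cap c               ≤⟨ balanced ⟩
      80 * e' (part c)             ∎
    n[10kf]≡k[10nf] : ∀ n k f → n * (10 * k * f) ≡ k * (10 * n * f)
    n[10kf]≡k[10nf] = solve-∀
    Y-bound : 2 ^ (∣ Y (part c) ∣ * (2 * e G)) ≤ n ^ (10 * n * e' (part c))
    Y-bound = 2^a≤n^b {log₂n} {n} (2^⌊log₂n⌋≤n 0<n) (begin
      ∣ Y (part c) ∣ * (2 * e G)    ≤⟨ *-mono-≤ (∣p∣≤n (Y (part c))) dense ⟩
      n * (10 * log₂n * e' (part c)) ≡⟨ n[10kf]≡k[10nf] n log₂n (e' (part c)) ⟩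
      log₂n * (10 * n * e' (part c)) ∎)

lemma4p2 : Σ ℕ λ d₀ → ∀ (n : ℕ) → 0 < n → (G : Graph n) → d₀ * n ≤ 2 * e G →
    Σ (BipartiteSubgraph G) λ H →
      (1 ≤ e' H)
      × (∣ X H ∣ * Δ' H ≤ 80 * e' H)
      × (2 ^ (∣ Y H ∣ * (2 * e G)) ≤ n ^ (10 * n * e' H))
lemma4p2 = 1024 , λ n 0<n G → Layering.bounded-part G 0<n
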